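{- Let $k \ge 0$ be an integer and let $D_1 \neq D_2$ be two of the four directions (horizontal, vertical, diagonal $(1,1)$, diagonal $(1,-1)$). Suppose $5k+1$ lines of direction $D_1$ and $5k+1$ lines of direction $D_2$ are drawn in $\mathbb{Z}^2$, where any two lines of the same direction share no lattice point. Then the union of all these lines contains at least $5(5k+1)+4$ lattice points.
   Context: A line (of length 5) is a set of 5 consecutive lattice points of $\mathbb{Z}^2$ along one of the four directions: horizontal, vertical, or one of the two diagonals. The lattice points covered by a collection of lines are the points of their union. In Morpion Solitaire 5D, lines of the same direction must be pairwise disjoint. -}

module Defs where

open import Data.Nat using (ℕ; _<_)
open import Data.Integer using (ℤ; +_; -[1+_]; _+_; _*_)
open import Data.Product using (_×_; _,_; Σ; ∃; proj₁; proj₂)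
open import Data.Fin using (Fin)
open import Data.Vec using (Vec; lookup)
open import Relation.Binary.PropositionalEquality using (_≡_)
open import Relation.Nullary using (¬_)

Point : Set
Point = ℤ × ℤ

data Direction : Set where
  horizontal vertical diagonal antidiagonal : Direction

step : Direction → Point
step horizontal   = (+ 1 , + 0)
step vertical     = (+ 0 , + 1)
step diagonal     = (+ 1 , + 1)
step antidiagonal = (+ 1 , -[1+ 0 ])

-- A line (of length 5) of direction d with starting point p is the set of
-- the 5 points p + i·step d, 0 ≤ i ≤ 4.
_onLine_from_ : Point → Direction → Point → Set
q onLine d from p = ∃ λ (i : ℕ) → (i < 5) ×
  (q ≡ (proj₁ p + (+ i) * proj₁ (step d) , proj₂ p + (+ i) * proj₂ (step d)))

Disjoint : Direction → Point → Point → Set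
Disjoint d p p' = ∀ q → q onLine d from p → ¬ (q onLine d from p')

PairwiseDisjoint : ∀ {n} → Direction → Vec Point n → Set
PairwiseDisjoint d ps = ∀ i j → ¬ (i ≡ j) → Disjoint d (lookup ps i) (lookup ps j)

Covered : ∀ {n} → Direction → Vec Point n → Point → Set
Covered d ps q = ∃ λ i → q onLine d from lookup ps i

-- For a direction e let φₑ be the linear form on ℤ² vanishing on
-- step e, and call φₑ(q) mod 5 the e-residue of q.  All points of an e-line
-- have the same e-residue, while the five points of a d-line (d ≠ e) have
-- five different e-residues, because φₑ(step d) ∈ {1, -1, 2} is invertible
-- modulo 5.  By pigeonhole, some residue r is the e-residue of at least k+1
-- of the 5k+1 D₂-lines (e = D₂), so at least 5(k+1) points covered by the
-- D₂-lines have residue r.  Each D₁-line contains only one point of residue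
-- r, so at most 5k+1 of these points lie on D₁-lines, and at least 4 of them
-- are covered by D₂ alone.  These 4 points together with the 5(5k+1)
-- distinct points of the D₁-lines give the required list.
module Submission where

open import Defs
open import Data.Nat using (ℕ; suc; _+_; _*_; _≤_; _<_; z≤n; s≤s)
import Data.Nat as ℕ
import Data.Nat.Properties as ℕP
open import Data.Nat.Divisibility using (_∣_; _∣?_; divides)
open import Data.Nat.ListAction using (sum)
open import Data.Nat.Tactic.RingSolver using () renaming (solve-∀ to ℕ-solve)
import Data.Integer as ℤ
import Data.Integer.Properties as ℤP
import Data.Integer.DivMod as ℤD
open import Data.Integer.Tactic.RingSolver using () renaming (solve-∀ to ℤ-solve)
open import Algebra.Bundles using (AbelianGroup)
open import Algebra.Properties.CommutativeSemigroup ℕP.+-commutativeSemigroup using (interchange)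
open import Algebra.Properties.Group (AbelianGroup.group ℤP.+-0-abelianGroup) using (∙-cancelˡ)
open import Data.Vec using (Vec; []; _∷_)
open import Data.List using (List; []; _∷_; length; _++_; filter; take; map; applyUpTo; upTo)
open import Data.List.Properties using (length-++; filter-++; filter-all; filter-none; length-take)
open import Data.List.Relation.Unary.All as All using (All; _∷_)
open import Data.List.Relation.Unary.All.Properties as AllP using (all-filter)
open import Data.List.Relation.Unary.AllPairs using ([]; _∷_)
open import Data.List.Relation.Unary.Any using (here; there)
open import Data.List.Relation.Unary.Unique.Propositional using (Unique)
import Data.List.Relation.Unary.Unique.Propositional.Properties as Unique
open import Data.List.Membership.Propositional using (_∈_)
open import Data.List.Membership.Propositional.Properties
  using (∈-++⁻; ∈-++⁺ˡ; ∈-++⁺ʳ; ∈-∃++; ∈-filter⁺; ∈-filter⁻; ∈-map⁻; ∈-applyUpTo⁻; ∈-upTo⁺)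
import Data.List.Membership.DecPropositional as DecMembership
open import Data.Fin using () renaming (zero to fzero; suc to fsuc)
import Data.Fin.Properties as FinP
open import Data.Sum using (_⊎_; inj₁; inj₂)
open import Data.Product using (Σ; _×_; _,_; proj₁; proj₂; ∃)
import Data.Product.Properties as ProductP
open import Data.Empty using (⊥; ⊥-elim)
open import Data.Unit using (tt)
open import Function using (_∘_)
open import Relation.Binary.Definitions using (DecidableEquality)
open import Relation.Binary.PropositionalEquality using (_≡_; _≢_; refl; sym; trans; cong; cong₂; subst; module ≡-Reasoning)
open import Relation.Nullary using (¬_; Dec; yes; no; ¬?)
open import Relation.Nullary.Decidable using (_→-dec_; toWitness)
open import Relation.Unary using (Pred; Decidable)

linePoint : Direction → Point → ℕ → Point
linePoint d p i = (proj₁ p ℤ.+ ℤ.+ i ℤ.* proj₁ (step d) , proj₂ p ℤ.+ ℤ.+ i ℤ.* proj₂ (step d))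

linePoints : Direction → Point → List Point
linePoints d p = applyUpTo (linePoint d p) 5

∈⇒onLine : ∀ d p {q} → q ∈ linePoints d p → q onLine d from p
∈⇒onLine d p = ∈-applyUpTo⁻ (linePoint d p)

unit-steps-injective : ∀ x {i j} → x ℤ.+ ℤ.+ i ℤ.* ℤ.+ 1 ≡ x ℤ.+ ℤ.+ j ℤ.* ℤ.+ 1 → i ≡ j
unit-steps-injective x {i} {j} eq =
  ℤP.+-injective (trans (sym (ℤP.*-identityʳ (ℤ.+ i)))
                 (trans (∙-cancelˡ x _ _ eq) (ℤP.*-identityʳ (ℤ.+ j))))

-- Every direction moves some coordinate by exactly 1, so distinct indices
-- give distinct points of a line.
linePoint-injective : ∀ d p {i j} → linePoint d p i ≡ linePoint d p j → i ≡ j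
linePoint-injective horizontal   p e = unit-steps-injective (proj₁ p) (cong proj₁ e)
linePoint-injective vertical     p e = unit-steps-injective (proj₂ p) (cong proj₂ e)
linePoint-injective diagonal     p e = unit-steps-injective (proj₁ p) (cong proj₁ e)
linePoint-injective antidiagonal p e = unit-steps-injective (proj₁ p) (cong proj₁ e)

linePoints-unique : ∀ d p → Unique (linePoints d p)
linePoints-unique d p =
  Unique.applyUpTo⁺₁ (linePoint d p) 5 (λ i<j _ e → ℕP.<⇒≢ i<j (linePoint-injective d p e))

familyPoints : ∀ {m} → Direction → Vec Point m → List Point
familyPoints d []       = []
familyPoints d (p ∷ ps) = linePoints d p ++ familyPoints d ps

familyPoints-length : ∀ {m} d (ps : Vec Point m) → length (familyPoints d ps) ≡ 5 * m
familyPoints-length d [] = refl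
familyPoints-length {suc m} d (p ∷ ps) = begin
  length (linePoints d p ++ familyPoints d ps)  ≡⟨ length-++ (linePoints d p) {familyPoints d ps} ⟩
  5 + length (familyPoints d ps)                ≡⟨ cong (5 +_) (familyPoints-length d ps) ⟩
  5 + 5 * m                                     ≡⟨ ℕP.*-suc 5 m ⟨
  5 * suc m                                     ∎
  where open ≡-Reasoning

familyPoints-covered : ∀ {m} d (ps : Vec Point m) {q} → q ∈ familyPoints d ps → Covered d ps q
familyPoints-covered d (p ∷ ps) q∈ with ∈-++⁻ (linePoints d p) q∈
... | inj₁ q∈line = fzero , ∈⇒onLine d p q∈line
... | inj₂ q∈rest with i , q∈lineᵢ ← familyPoints-covered d ps q∈rest = fsuc i , q∈lineᵢ

familyPoints-unique : ∀ {m} d (ps : Vec Point m) → PairwiseDisjoint d ps → Unique (familyPoints d ps)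
familyPoints-unique d [] _ = []
familyPoints-unique d (p ∷ ps) disjoint =
  Unique.++⁺ (linePoints-unique d p) (familyPoints-unique d ps disjoint-tail) separated
  where
  disjoint-tail : PairwiseDisjoint d ps
  disjoint-tail i j i≢j = disjoint (fsuc i) (fsuc j) (i≢j ∘ FinP.suc-injective)
  separated : ∀ {q} → q ∈ linePoints d p × q ∈ familyPoints d ps → ⊥
  separated {q} (q∈line , q∈rest) with i , q∈lineᵢ ← familyPoints-covered d ps q∈rest =
    disjoint fzero (fsuc i) (λ ()) q (∈⇒onLine d p q∈line) q∈lineᵢ

module _ {A : Set} where

  unique-⊆-length : ∀ {xs ys : List A} → Unique xs → (∀ {x} → x ∈ xs → x ∈ ys) →
                    length xs ≤ length ys
  unique-⊆-length {[]}     _              _   = z≤n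
  unique-⊆-length {x ∷ xs} {ys} (x∉xs ∷ u) xs⊆ys
    with ys₁ , ys₂ , refl ← ∈-∃++ (xs⊆ys (here refl)) =
    subst (suc (length xs) ≤_) (sym length-split) (s≤s (unique-⊆-length u xs⊆ys₁ys₂))
    where
    length-split : length (ys₁ ++ x ∷ ys₂) ≡ suc (length (ys₁ ++ ys₂))
    length-split = begin
      length (ys₁ ++ x ∷ ys₂)         ≡⟨ length-++ ys₁ ⟩
      length ys₁ + suc (length ys₂)   ≡⟨ ℕP.+-suc (length ys₁) (length ys₂) ⟩
      suc (length ys₁ + length ys₂)   ≡⟨ cong suc (length-++ ys₁) ⟨
      suc (length (ys₁ ++ ys₂))       ∎
      where open ≡-Reasoning
    xs⊆ys₁ys₂ : ∀ {y} → y ∈ xs → y ∈ ys₁ ++ ys₂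
    xs⊆ys₁ys₂ y∈xs with ∈-++⁻ ys₁ (xs⊆ys (there y∈xs))
    ... | inj₁ y∈ys₁         = ∈-++⁺ˡ y∈ys₁
    ... | inj₂ (here y≡x)    = ⊥-elim (All.lookup x∉xs y∈xs (sym y≡x))
    ... | inj₂ (there y∈ys₂) = ∈-++⁺ʳ ys₁ y∈ys₂

  unique-constant-length : ∀ {xs : List A} → Unique xs →
                           (∀ {x y} → x ∈ xs → y ∈ xs → x ≡ y) → length xs ≤ 1
  unique-constant-length {[]}             _                 _        = z≤n
  unique-constant-length {_ ∷ []}         _                 _        = s≤s z≤n
  unique-constant-length {_ ∷ _ ∷ _} ((x≢y ∷ _) ∷ _) constant =
    ⊥-elim (x≢y (constant (here refl) (there (here refl))))

  ∈-take : ∀ n {xs : List A} {x} → x ∈ take n xs → x ∈ xs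
  ∈-take (suc n) {_ ∷ _} (here x≡y)  = here x≡y
  ∈-take (suc n) {_ ∷ _} (there x∈) = there (∈-take n x∈)

  length-filter-split : ∀ {ℓ} {P : Pred A ℓ} (P? : Decidable P) xs →
                        length (filter P? xs) + length (filter (¬? ∘ P?) xs) ≡ length xs
  length-filter-split P? [] = refl
  length-filter-split P? (x ∷ xs) with P? x
  ... | yes _ = cong suc (length-filter-split P? xs)
  ... | no  _ = trans (ℕP.+-suc _ _) (cong suc (length-filter-split P? xs))

module _ {A : Set} (_≟_ : DecidableEquality A) where

  open DecMembership _≟_ using (_∈?_; _∉?_)

  -- If a duplicate-free list xs lies inside P and at most b elements of ys
  -- lie in P, then at most b elements of xs belong to ys; so at least a of
  -- them lie outside ys whenever a + b ≤ length xs.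
  many-outside : ∀ {ℓ} {P : Pred A ℓ} (P? : Decidable P) {xs ys : List A} {a b} →
                 Unique xs → All P xs → length (filter P? ys) ≤ b → a + b ≤ length xs →
                 a ≤ length (filter (_∉? ys) xs)
  many-outside P? {xs} {ys} {a} {b} unique all-P few enough =
    ℕP.+-cancelʳ-≤ b a outside (begin
      a + b              ≤⟨ enough ⟩
      length xs          ≡⟨ length-filter-split (_∈? ys) xs ⟨
      inside + outside   ≤⟨ ℕP.+-monoˡ-≤ outside inside≤b ⟩
      b + outside        ≡⟨ ℕP.+-comm b outside ⟩
      outside + b        ∎)
    where
    open ℕP.≤-Reasoning
    inside outside : ℕ
    inside  = length (filter (_∈? ys) xs)
    outside = length (filter (_∉? ys) xs)
    inside⊆ : ∀ {x} → x ∈ filter (_∈? ys) xs → x ∈ filter P? ys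
    inside⊆ x∈ with x∈xs , x∈ys ← ∈-filter⁻ (_∈? ys) {xs = xs} x∈ =
      ∈-filter⁺ P? x∈ys (All.lookup all-P x∈xs)
    inside≤b : inside ≤ b
    inside≤b = ℕP.≤-trans (unique-⊆-length (Unique.filter⁺ (_∈? ys) unique) inside⊆) few

pigeonhole : ∀ k (ns : List ℕ) → length ns * k < sum ns → ∃ λ n → n ∈ ns × k < n
pigeonhole k (n ∷ ns) bound with k ℕ.<? n
... | yes k<n = n , here refl , k<n
... | no  k≮n = let m , m∈ns , k<m = pigeonhole k ns tail-bound in m , there m∈ns , k<m
  where
  tail-bound : length ns * k < sum ns
  tail-bound = ℕP.+-cancelˡ-< k _ _
    (ℕP.<-≤-trans bound (ℕP.+-monoˡ-≤ (sum ns) (ℕP.≮⇒≥ k≮n)))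

sum-map-+ : ∀ {B : Set} (f g : B → ℕ) xs →
            sum (map (λ x → f x + g x) xs) ≡ sum (map f xs) + sum (map g xs)
sum-map-+ f g [] = refl
sum-map-+ f g (x ∷ xs) = trans (cong (f x + g x +_) (sum-map-+ f g xs))
                               (interchange (f x) (g x) (sum (map f xs)) (sum (map g xs)))

-- Coefficients (a , b) of the linear form φₑ(x , y) = a·x + b·y, chosen so
-- that φₑ vanishes on step e.
formCoefficients : Direction → ℤ.ℤ × ℤ.ℤ
formCoefficients horizontal   = (ℤ.+ 0 , ℤ.+ 1)
formCoefficients vertical     = (ℤ.+ 1 , ℤ.+ 0)
formCoefficients diagonal     = (ℤ.+ 1 , ℤ.-[1+ 0 ])
formCoefficients antidiagonal = (ℤ.+ 1 , ℤ.+ 1)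

form : Direction → Point → ℤ.ℤ
form e q = proj₁ (formCoefficients e) ℤ.* proj₁ q ℤ.+ proj₂ (formCoefficients e) ℤ.* proj₂ q

slope : Direction → Direction → ℤ.ℤ
slope e d = form e (step d)

slope-self : ∀ e → slope e e ≡ ℤ.+ 0
slope-self horizontal   = refl
slope-self vertical     = refl
slope-self diagonal     = refl
slope-self antidiagonal = refl

form-linePoint : ∀ e d p i → form e (linePoint d p i) ≡ form e p ℤ.+ ℤ.+ i ℤ.* slope e d
form-linePoint e d p i =
  linearity (proj₁ (formCoefficients e)) (proj₂ (formCoefficients e))
            (proj₁ p) (proj₂ p) (ℤ.+ i) (proj₁ (step d)) (proj₂ (step d))
  where
  linearity : ∀ a b x y t u v →
              a ℤ.* (x ℤ.+ t ℤ.* u) ℤ.+ b ℤ.* (y ℤ.+ t ℤ.* v) ≡ (a ℤ.* x ℤ.+ b ℤ.* y) ℤ.+ t ℤ.* (a ℤ.* u ℤ.+ b ℤ.* v)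
  linearity = ℤ-solve

residue : Direction → Point → ℕ
residue e q = form e q ℤD.%ℕ 5

residue<5 : ∀ e q → residue e q < 5
residue<5 e q = ℤD.n%ℕd<d (form e q) 5

residue-constant : ∀ e p {q} → q onLine e from p → residue e q ≡ residue e p
residue-constant e p (i , _ , refl) = cong (ℤD._%ℕ 5) (begin
  form e (linePoint e p i)             ≡⟨ form-linePoint e e p i ⟩
  form e p ℤ.+ ℤ.+ i ℤ.* slope e e     ≡⟨ cong (λ s → form e p ℤ.+ ℤ.+ i ℤ.* s) (slope-self e) ⟩
  form e p ℤ.+ ℤ.+ i ℤ.* ℤ.+ 0         ≡⟨ cong (λ z → form e p ℤ.+ z) (ℤP.*-zeroʳ (ℤ.+ i)) ⟩
  form e p ℤ.+ ℤ.+ 0                   ≡⟨ ℤP.+-identityʳ (form e p) ⟩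
  form e p                             ∎)
  where open ≡-Reasoning

%ℕ-equal⇒∣ : ∀ n .{{_ : ℕ.NonZero n}} a b → a ℤD.%ℕ n ≡ b ℤD.%ℕ n → n ∣ ℤ.∣ a ℤ.- b ∣
%ℕ-equal⇒∣ n a b same-remainder =
  divides ℤ.∣ qa ℤ.- qb ∣ (trans (cong ℤ.∣_∣ difference) (ℤP.abs-* (qa ℤ.- qb) (ℤ.+ n)))
  where
  qa qb : ℤ.ℤ
  qa = a ℤD./ℕ n
  qb = b ℤD./ℕ n
  cancel-remainder : ∀ r x y m → (r ℤ.+ x ℤ.* m) ℤ.- (r ℤ.+ y ℤ.* m) ≡ (x ℤ.- y) ℤ.* m
  cancel-remainder = ℤ-solve
  difference : a ℤ.- b ≡ (qa ℤ.- qb) ℤ.* ℤ.+ n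
  difference = begin
    a ℤ.- b                                                    ≡⟨ cong₂ ℤ._-_ (ℤD.a≡a%ℕn+[a/ℕn]*n a n) (ℤD.a≡a%ℕn+[a/ℕn]*n b n) ⟩
    (ℤ.+ (a ℤD.%ℕ n) ℤ.+ qa ℤ.* ℤ.+ n) ℤ.- (ℤ.+ (b ℤD.%ℕ n) ℤ.+ qb ℤ.* ℤ.+ n)
      ≡⟨ cong (λ r → (ℤ.+ (a ℤD.%ℕ n) ℤ.+ qa ℤ.* ℤ.+ n) ℤ.- (ℤ.+ r ℤ.+ qb ℤ.* ℤ.+ n)) (sym same-remainder) ⟩
    (ℤ.+ (a ℤD.%ℕ n) ℤ.+ qa ℤ.* ℤ.+ n) ℤ.- (ℤ.+ (a ℤD.%ℕ n) ℤ.+ qb ℤ.* ℤ.+ n)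
      ≡⟨ cancel-remainder (ℤ.+ (a ℤD.%ℕ n)) qa qb (ℤ.+ n) ⟩
    (qa ℤ.- qb) ℤ.* ℤ.+ n                                      ∎
    where open ≡-Reasoning

-- The slopes between two different directions: units modulo 5.
data UnitMod5 : ℤ.ℤ → Set where
  one       : UnitMod5 (ℤ.+ 1)
  minus-one : UnitMod5 ℤ.-[1+ 0 ]
  two       : UnitMod5 (ℤ.+ 2)

slope-unit : ∀ d e → d ≢ e → UnitMod5 (slope e d)
slope-unit horizontal   horizontal   d≢e = ⊥-elim (d≢e refl)
slope-unit horizontal   vertical     _   = one
slope-unit horizontal   diagonal     _   = one
slope-unit horizontal   antidiagonal _   = one
slope-unit vertical     horizontal   _   = one
slope-unit vertical     vertical     d≢e = ⊥-elim (d≢e refl)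
slope-unit vertical     diagonal     _   = minus-one
slope-unit vertical     antidiagonal _   = one
slope-unit diagonal     horizontal   _   = one
slope-unit diagonal     vertical     _   = one
slope-unit diagonal     diagonal     d≢e = ⊥-elim (d≢e refl)
slope-unit diagonal     antidiagonal _   = two
slope-unit antidiagonal horizontal   _   = minus-one
slope-unit antidiagonal vertical     _   = one
slope-unit antidiagonal diagonal     _   = two
slope-unit antidiagonal antidiagonal d≢e = ⊥-elim (d≢e refl)

Separates : ℤ.ℤ → Set
Separates c = All (λ i → All (λ j → 5 ∣ ℤ.∣ (ℤ.+ i ℤ.- ℤ.+ j) ℤ.* c ∣ → i ≡ j) (upTo 5)) (upTo 5)

separates? : ∀ c → Dec (Separates c)
separates? c = All.all? (λ i → All.all? (λ j → (5 ∣? _) →-dec (i ℕ.≟ j)) (upTo 5)) (upTo 5)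

unit-separates : ∀ {c} → UnitMod5 c → ∀ {i j} → i < 5 → j < 5 →
                 5 ∣ ℤ.∣ (ℤ.+ i ℤ.- ℤ.+ j) ℤ.* c ∣ → i ≡ j
unit-separates u i<5 j<5 = All.lookup (All.lookup (separating u) (∈-upTo⁺ i<5)) (∈-upTo⁺ j<5)
  where
  separating : ∀ {c} → UnitMod5 c → Separates c
  separating one       = toWitness {a? = separates? _} tt
  separating minus-one = toWitness {a? = separates? _} tt
  separating two       = toWitness {a? = separates? _} tt

residue-injective : ∀ d e p → d ≢ e → ∀ {x y} → x ∈ linePoints d p → y ∈ linePoints d p →
                    residue e x ≡ residue e y → x ≡ y
residue-injective d e p d≢e x∈ y∈ same-residue
  with i , i<5 , refl ← ∈⇒onLine d p x∈ | j , j<5 , refl ← ∈⇒onLine d p y∈ =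
  cong (linePoint d p) (unit-separates (slope-unit d e d≢e) i<5 j<5 divisible)
  where
  offset : ∀ f s t c → (f ℤ.+ s ℤ.* c) ℤ.- (f ℤ.+ t ℤ.* c) ≡ (s ℤ.- t) ℤ.* c
  offset = ℤ-solve
  difference : form e (linePoint d p i) ℤ.- form e (linePoint d p j) ≡ (ℤ.+ i ℤ.- ℤ.+ j) ℤ.* slope e d
  difference = trans (cong₂ ℤ._-_ (form-linePoint e d p i) (form-linePoint e d p j))
                     (offset (form e p) (ℤ.+ i) (ℤ.+ j) (slope e d))
  divisible : 5 ∣ ℤ.∣ (ℤ.+ i ℤ.- ℤ.+ j) ℤ.* slope e d ∣
  divisible = subst (λ z → 5 ∣ ℤ.∣ z ∣) difference
                    (%ℕ-equal⇒∣ 5 (form e (linePoint d p i)) (form e (linePoint d p j)) same-residue)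

inClass? : ∀ e r → Decidable (λ q → residue e q ≡ r)
inClass? e r q = residue e q ℕ.≟ r

line-transversal-count : ∀ d e r p → d ≢ e → length (filter (inClass? e r) (linePoints d p)) ≤ 1
line-transversal-count d e r p d≢e =
  unique-constant-length (Unique.filter⁺ (inClass? e r) (linePoints-unique d p)) same-point
  where
  same-point : ∀ {x y} → x ∈ filter (inClass? e r) (linePoints d p) →
               y ∈ filter (inClass? e r) (linePoints d p) → x ≡ y
  same-point x∈ y∈
    with x∈line , x∈class ← ∈-filter⁻ (inClass? e r) {xs = linePoints d p} x∈
       | y∈line , y∈class ← ∈-filter⁻ (inClass? e r) {xs = linePoints d p} y∈ =
    residue-injective d e p d≢e x∈line y∈line (trans x∈class (sym y∈class))

transversal-count : ∀ {m} d e r (ps : Vec Point m) → d ≢ e →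
                    length (filter (inClass? e r) (familyPoints d ps)) ≤ m
transversal-count d e r [] _ = z≤n
transversal-count d e r (p ∷ ps) d≢e = begin
  length (filter (inClass? e r) (linePoints d p ++ familyPoints d ps))
    ≡⟨ cong length (filter-++ (inClass? e r) (linePoints d p) (familyPoints d ps)) ⟩
  length (filter (inClass? e r) (linePoints d p) ++ filter (inClass? e r) (familyPoints d ps))
    ≡⟨ length-++ (filter (inClass? e r) (linePoints d p)) ⟩
  length (filter (inClass? e r) (linePoints d p)) + length (filter (inClass? e r) (familyPoints d ps))
    ≤⟨ ℕP.+-mono-≤ (line-transversal-count d e r p d≢e) (transversal-count d e r ps d≢e) ⟩
  1 + _ ∎
  where open ℕP.≤-Reasoning

indicator : ∀ {A : Set} → Dec A → ℕ
indicator (yes _) = 1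
indicator (no _)  = 0

classSize : ∀ {m} → Direction → ℕ → Vec Point m → ℕ
classSize e r []       = 0
classSize e r (p ∷ ps) = indicator (residue e p ℕ.≟ r) + classSize e r ps

line-parallel-count : ∀ e r p →
                      length (filter (inClass? e r) (linePoints e p)) ≡ 5 * indicator (residue e p ℕ.≟ r)
line-parallel-count e r p with residue e p ℕ.≟ r
... | yes p∈class = cong length (filter-all (inClass? e r) (All.tabulate λ q∈ →
                      trans (residue-constant e p (∈⇒onLine e p q∈)) p∈class))
... | no  p∉class = cong length (filter-none (inClass? e r) (All.tabulate λ q∈ q∈class →
                      p∉class (trans (sym (residue-constant e p (∈⇒onLine e p q∈))) q∈class)))

parallel-count : ∀ {m} e r (ps : Vec Point m) →
                 length (filter (inClass? e r) (familyPoints e ps)) ≡ 5 * classSize e r ps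
parallel-count e r [] = refl
parallel-count e r (p ∷ ps) = begin
  length (filter (inClass? e r) (linePoints e p ++ familyPoints e ps))
    ≡⟨ cong length (filter-++ (inClass? e r) (linePoints e p) (familyPoints e ps)) ⟩
  length (filter (inClass? e r) (linePoints e p) ++ filter (inClass? e r) (familyPoints e ps))
    ≡⟨ length-++ (filter (inClass? e r) (linePoints e p)) ⟩
  length (filter (inClass? e r) (linePoints e p)) + length (filter (inClass? e r) (familyPoints e ps))
    ≡⟨ cong₂ _+_ (line-parallel-count e r p) (parallel-count e r ps) ⟩
  5 * indicator (residue e p ℕ.≟ r) + 5 * classSize e r ps
    ≡⟨ ℕP.*-distribˡ-+ 5 (indicator (residue e p ℕ.≟ r)) (classSize e r ps) ⟨
  5 * classSize e r (p ∷ ps) ∎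
  where open ≡-Reasoning

indicator-sum : ∀ v → v < 5 → sum (map (λ r → indicator (v ℕ.≟ r)) (upTo 5)) ≡ 1
indicator-sum 0 _ = refl
indicator-sum 1 _ = refl
indicator-sum 2 _ = refl
indicator-sum 3 _ = refl
indicator-sum 4 _ = refl
indicator-sum (suc (suc (suc (suc (suc _))))) (s≤s (s≤s (s≤s (s≤s (s≤s ())))))

classSizes-sum : ∀ {m} e (ps : Vec Point m) → sum (map (λ r → classSize e r ps) (upTo 5)) ≡ m
classSizes-sum e [] = refl
classSizes-sum e (p ∷ ps) =
  trans (sum-map-+ (λ r → indicator (residue e p ℕ.≟ r)) (λ r → classSize e r ps) (upTo 5))
        (cong₂ _+_ (indicator-sum (residue e p) (residue<5 e p)) (classSizes-sum e ps))

large-class : ∀ k e (ps : Vec Point (5 * k + 1)) → ∃ λ r → k < classSize e r ps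
large-class k e ps = class-of (pigeonhole k sizes bound)
  where
  sizes : List ℕ
  sizes = map (λ r → classSize e r ps) (upTo 5)
  bound : 5 * k < sum sizes
  bound = subst (5 * k <_) (sym (classSizes-sum e ps)) (ℕP.m<m+n (5 * k) (s≤s z≤n))
  class-of : (∃ λ n → n ∈ sizes × k < n) → ∃ λ r → k < classSize e r ps
  class-of (_ , size∈ , k<size) with r , _ , refl ← ∈-map⁻ (λ r → classSize e r ps) size∈ = r , k<size

_≟-point_ : DecidableEquality Point
_≟-point_ = ProductP.≡-dec ℤP._≟_ ℤP._≟_

open DecMembership _≟-point_ using (_∉?_)

-- Four distinct points covered by the D₂-lines but lying on no D₁-line: a
-- large residue class of the D₂-lines has 5(k+1) points, of which at most
-- 5k+1 are on D₁-lines.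
extra-points : ∀ k D₁ D₂ → D₁ ≢ D₂ → (L₁ L₂ : Vec Point (5 * k + 1)) → PairwiseDisjoint D₂ L₂ →
               Σ (List Point) λ qs → Unique qs × All (Covered D₂ L₂) qs ×
                 All (λ q → ¬ q ∈ familyPoints D₁ L₁) qs × length qs ≡ 4
extra-points k D₁ D₂ D₁≢D₂ L₁ L₂ disjoint₂ =
  take 4 fresh ,
  Unique.take⁺ 4 (Unique.filter⁺ (_∉? points₁) class-unique) ,
  All.tabulate (λ q∈ → familyPoints-covered D₂ L₂ (on-D₂-line (∈-take 4 q∈))) ,
  All.tabulate (λ q∈ → proj₂ (∈-filter⁻ (_∉? points₁) {xs = class} (∈-take 4 q∈))) ,
  trans (length-take 4 fresh) (ℕP.m≤n⇒m⊓n≡m four-fresh)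
  where
  r : ℕ
  r = proj₁ (large-class k D₂ L₂)
  points₁ points₂ class fresh : List Point
  points₁ = familyPoints D₁ L₁
  points₂ = familyPoints D₂ L₂
  class   = filter (inClass? D₂ r) points₂
  fresh   = filter (_∉? points₁) class
  class-unique : Unique class
  class-unique = Unique.filter⁺ (inClass? D₂ r) (familyPoints-unique D₂ L₂ disjoint₂)
  on-D₂-line : ∀ {q} → q ∈ fresh → q ∈ points₂
  on-D₂-line q∈ = proj₁ (∈-filter⁻ (inClass? D₂ r) {xs = points₂}
                           (proj₁ (∈-filter⁻ (_∉? points₁) {xs = class} q∈)))
  large : 4 + (5 * k + 1) ≤ length class
  large = begin
    4 + (5 * k + 1)    ≡⟨ expand k ⟩
    5 * suc k          ≤⟨ ℕP.*-monoʳ-≤ 5 (proj₂ (large-class k D₂ L₂)) ⟩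
    5 * classSize D₂ r L₂ ≡⟨ parallel-count D₂ r L₂ ⟨
    length class       ∎
    where
    open ℕP.≤-Reasoning
    expand : ∀ k → 4 + (5 * k + 1) ≡ 5 * suc k
    expand = ℕ-solve
  four-fresh : 4 ≤ length fresh
  four-fresh = many-outside _≟-point_ (inClass? D₂ r) class-unique
                 (all-filter (inClass? D₂ r) points₂) (transversal-count D₁ D₂ r L₁ D₁≢D₂) large

lemma2 : (k : ℕ) (D₁ D₂ : Direction) → ¬ (D₁ ≡ D₂) →
    (L₁ L₂ : Vec Point (5 * k + 1)) →
    PairwiseDisjoint D₁ L₁ → PairwiseDisjoint D₂ L₂ →
    Σ (List Point) (λ qs →
    Unique qs ×
    All (λ q → Covered D₁ L₁ q ⊎ Covered D₂ L₂ q) qs ×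
    length qs ≡ 5 * (5 * k + 1) + 4)
lemma2 k D₁ D₂ D₁≢D₂ L₁ L₂ disjoint₁ disjoint₂
  with extra , extra-unique , extra-covered , extra-outside , extra-length
       ← extra-points k D₁ D₂ D₁≢D₂ L₁ L₂ disjoint₂ =
  familyPoints D₁ L₁ ++ extra ,
  Unique.++⁺ (familyPoints-unique D₁ L₁ disjoint₁) extra-unique
             (λ (q∈₁ , q∈extra) → All.lookup extra-outside q∈extra q∈₁) ,
  AllP.++⁺ (All.tabulate (inj₁ ∘ familyPoints-covered D₁ L₁)) (All.map inj₂ extra-covered) ,
  trans (length-++ (familyPoints D₁ L₁))
        (cong₂ _+_ (familyPoints-length D₁ L₁) extra-length)
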